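{- Let $a,b\in\mathbb{O}$ be rational (resp. integral) octonions. Then the four quantities ${\cal{N}}(a+b)$, ${\cal{N}}(ab)$, ${\cal{S}}(a+b)$, ${\cal{S}}(ab)$ all lie in $\mathbb{Q}$ (resp. in $\mathbb{Z}$), i.e. $a$ and $b$ belong to a rational (resp. integral) non-associative Brandt algebra, if and only if $2\langle a,b\rangle\in\mathbb{Q}$ and $2\langle a,\overline{b}\rangle\in\mathbb{Q}$ (resp. both lie in $\mathbb{Z}$), where $\langle\cdot,\cdot\rangle$ is the Euclidean scalar product on $\mathbb{O}\cong\mathbb{R}^8$.
   Context: $\mathbb{O}$ denotes the real octonions with basis $1,e_1,\dots,e_7$ and conjugation $\overline{x_0+\sum_j x_je_j}=x_0-\sum_j x_je_j$. For $z\in\mathbb{O}$, the trace is ${\cal{S}}(z)=z+\overline{z}=2x_0$ and the norm is ${\cal{N}}(z)=z\overline{z}=|z|^2$. An octonion $z$ is called rational (resp. integral) if ${\cal{S}}(z)$ and ${\cal{N}}(z)$ both lie in $\mathbb{Q}$ (resp. in $\mathbb{Z}$). A set of rational (integral) octonions forms a rational (integral) Brandt algebra when norms and traces of sums and products of its elements are again in $\mathbb{Q}$ (resp. $\mathbb{Z}$). -}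

module Defs where

open import Level using (0ℓ)
open import Algebra.Bundles using (CommutativeRing)
open import Data.Nat using (ℕ; zero; suc)
open import Data.Integer using (ℤ; +_; -[1+_])
open import Data.Product using (Σ; ∃; _×_; _,_)
open import Relation.Nullary using (¬_)
import Data.Sum

-- An axiomatisation of the real numbers: a complete ordered field.
-- (agda-stdlib has no real numbers; the theorem is stated for every model of
-- these axioms, which classically is ℝ up to isomorphism.)
record RealField : Set₁ where
  field
    commutativeRing : CommutativeRing 0ℓ 0ℓ
  open CommutativeRing commutativeRing public
  field
    0≉1      : ¬ (0# ≈ 1#)
    inverse  : ∀ x → ¬ (x ≈ 0#) → Σ Carrier λ y → x * y ≈ 1#
    _<_      : Carrier → Carrier → Set
    <-irrefl : ∀ {x y} → x ≈ y → ¬ (x < y)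
    <-trans  : ∀ {x y z} → x < y → y < z → x < z
    <-resp-≈ : ∀ {x x′ y y′} → x ≈ x′ → y ≈ y′ → x < y → x′ < y′
    <-tri    : ∀ x y → (x < y) Data.Sum.⊎ ((x ≈ y) Data.Sum.⊎ (y < x))
    +-mono-< : ∀ {x y} z → x < y → (x + z) < (y + z)
    *-pos    : ∀ {x y} → 0# < x → 0# < y → 0# < (x * y)
    sup      : (P : Carrier → Set) → Σ Carrier P →
               Σ Carrier (λ b → ∀ x → P x → (x < b) Data.Sum.⊎ (x ≈ b)) →
               Σ Carrier λ s →
                 (∀ x → P x → (x < s) Data.Sum.⊎ (x ≈ s)) ×
                 (∀ b → (∀ x → P x → (x < b) Data.Sum.⊎ (x ≈ b)) →
                        (s < b) Data.Sum.⊎ (s ≈ b))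

module _ (R : RealField) where
  open RealField R

  ιℕ : ℕ → Carrier
  ιℕ zero    = 0#
  ιℕ (suc n) = 1# + ιℕ n

  ιℤ : ℤ → Carrier
  ιℤ (+ n)      = ιℕ n
  ιℤ -[1+ n ]   = - ιℕ (suc n)

  -- a real number lies in ℚ  (r = n / (d+1))
  IsRat : Carrier → Set
  IsRat r = Σ ℤ λ n → Σ ℕ λ d → ιℕ (suc d) * r ≈ ιℤ n

  IsInt : Carrier → Set
  IsInt r = Σ ℤ λ n → r ≈ ιℤ n

  -- Octonions via the Cayley–Dickson construction ℝ ⊂ ℂ ⊂ ℍ ⊂ 𝕆,
  -- (p,q)(r,s) = (pr − s̄q, sp + q r̄),  conj (p,q) = (p̄, −q).
  -- The 8 real coordinates (x₀,…,x₇) are the leaves, x₀ = real part.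
  Cx : Set
  Cx = Carrier × Carrier
  Qt : Set
  Qt = Cx × Cx
  Oct : Set
  Oct = Qt × Qt

  conjC : Cx → Cx
  conjC (a , b) = (a , - b)
  addC : Cx → Cx → Cx
  addC (a , b) (c , d) = (a + c , b + d)
  negC : Cx → Cx
  negC (a , b) = (- a , - b)
  mulC : Cx → Cx → Cx
  mulC (p , q) (r , s) = (p * r - s * q , s * p + q * r)
  dotC : Cx → Cx → Carrier
  dotC (a , b) (c , d) = a * c + b * d

  conjQ : Qt → Qt
  conjQ (p , q) = (conjC p , negC q)
  addQ : Qt → Qt → Qt
  addQ (p , q) (r , s) = (addC p r , addC q s)
  negQ : Qt → Qt
  negQ (p , q) = (negC p , negC q)
  mulQ : Qt → Qt → Qt
  mulQ (p , q) (r , s) =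
    (addC (mulC p r) (negC (mulC (conjC s) q)) , addC (mulC s p) (mulC q (conjC r)))
  dotQ : Qt → Qt → Carrier
  dotQ (p , q) (r , s) = dotC p r + dotC q s

  conjO : Oct → Oct
  conjO (p , q) = (conjQ p , negQ q)
  addO : Oct → Oct → Oct
  addO (p , q) (r , s) = (addQ p r , addQ q s)
  mulO : Oct → Oct → Oct
  mulO (p , q) (r , s) =
    (addQ (mulQ p r) (negQ (mulQ (conjQ s) q)) , addQ (mulQ s p) (mulQ q (conjQ r)))

  ⟪_,_⟫ : Oct → Oct → Carrier
  ⟪ (p , q) , (r , s) ⟫ = dotQ p r + dotQ q s

  re : Oct → Carrier
  re (((x₀ , _) , _) , _) = x₀

  -- trace S(z) = z + z̄ = 2x₀ and norm N(z) = z z̄ = |z|²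
  𝒮 : Oct → Carrier
  𝒮 z = re z + re z
  𝒩 : Oct → Carrier
  𝒩 z = ⟪ z , z ⟫

  RationalOct : Oct → Set
  RationalOct z = IsRat (𝒮 z) × IsRat (𝒩 z)
  IntegralOct : Oct → Set
  IntegralOct z = IsInt (𝒮 z) × IsInt (𝒩 z)

module Submission where

-- The proof rests on four polynomial identities in the sixteen coordinates
-- of a and b:
--     𝒩(a+b) = 𝒩a + 𝒩b + 2⟨a,b⟩,   𝒩(ab) = 𝒩a 𝒩b,
--     𝒮(a+b) = 𝒮a + 𝒮b,            𝒮(ab) = 2⟨a,b̄⟩.
-- Given them, both directions only use that the set of admissible reals is
-- closed under ring operations, so we prove one criterion for an arbitrary
-- "subring predicate" and instantiate it with ℚ and with ℤ.

open import Data.Nat as ℕ using (zero; suc)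
import Data.Nat.Properties as ℕ
open import Data.Integer as ℤ using (+_; -[1+_]; _⊖_)
import Data.Integer.Properties as ℤ
open import Data.Integer.Base using (+-*-rawRing)
open import Data.Sign.Base as Sign using ()
open import Data.Product using (_×_; _,_)
open import Data.Vec using (Vec; []; _∷_; _++_)
open import Data.Fin using (#_)
open import Data.Maybe using (Maybe; just; nothing)
open import Relation.Nullary using (yes; no)
open import Function.Bundles using (_⇔_; mk⇔)
import Relation.Binary.PropositionalEquality as ≡
import Algebra.Solver.Ring.AlmostCommutativeRing as AlmostCommutativeRing

-- The octonion operations of Defs, written over any carrier with operations
-- named like those of a ring.  Instantiated at symbolic polynomials, the
-- evaluation of such an expression unfolds definitionally to the matching
-- expression of Defs, so the ring solver can prove octonion identities.
module CayleyDickson {A : Set} (_⊕_ _⊗_ _⊖_ : A → A → A) (⊝_ : A → A) where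
  C : Set
  C = A × A
  Q : Set
  Q = C × C
  O : Set
  O = Q × Q

  conjC : C → C
  conjC (a , b) = (a , ⊝ b)
  addC : C → C → C
  addC (a , b) (c , d) = (a ⊕ c , b ⊕ d)
  negC : C → C
  negC (a , b) = (⊝ a , ⊝ b)
  mulC : C → C → C
  mulC (p , q) (r , s) = ((p ⊗ r) ⊖ (s ⊗ q) , (s ⊗ p) ⊕ (q ⊗ r))
  dotC : C → C → A
  dotC (a , b) (c , d) = (a ⊗ c) ⊕ (b ⊗ d)

  conjQ : Q → Q
  conjQ (p , q) = (conjC p , negC q)
  addQ : Q → Q → Q
  addQ (p , q) (r , s) = (addC p r , addC q s)
  negQ : Q → Q
  negQ (p , q) = (negC p , negC q)
  mulQ : Q → Q → Q
  mulQ (p , q) (r , s) =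
    (addC (mulC p r) (negC (mulC (conjC s) q)) , addC (mulC s p) (mulC q (conjC r)))
  dotQ : Q → Q → A
  dotQ (p , q) (r , s) = dotC p r ⊕ dotC q s

  conjO : O → O
  conjO (p , q) = (conjQ p , negQ q)
  addO : O → O → O
  addO (p , q) (r , s) = (addQ p r , addQ q s)
  mulO : O → O → O
  mulO (p , q) (r , s) =
    (addQ (mulQ p r) (negQ (mulQ (conjQ s) q)) , addQ (mulQ s p) (mulQ q (conjQ r)))
  dot : O → O → A
  dot (p , q) (r , s) = dotQ p r ⊕ dotQ q s

  re : O → A
  re (((x₀ , _) , _) , _) = x₀

  trace : O → A
  trace z = re z ⊕ re z
  norm : O → A
  norm z = dot z z

-- Opened only after CayleyDickson, whose names would otherwise clash.
open import Defs

module _ (R : RealField) where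
  open RealField R
  open import Algebra.Properties.Ring ring
    using (-‿distribˡ-*; -‿distribʳ-*; -‿involutive; -‿+-comm; -0#≈0#)
  open import Relation.Binary.Reasoning.Setoid setoid
  open import Algebra.Properties.Semiring.Mult semiring
    using (×-homo-+; ×1-homo-*) renaming (_×_ to _·_)

  -- ιℕ n is the n-fold sum  n · 1#  of the library, so the library's facts on
  -- multiples make ιℕ a semiring homomorphism ℕ → ℝ.
  ιℕ≈·1# : ∀ n → ιℕ R n ≈ n · 1#
  ιℕ≈·1# zero    = refl
  ιℕ≈·1# (suc n) = +-congˡ (ιℕ≈·1# n)

  ιℕ-+ : ∀ m n → ιℕ R (m ℕ.+ n) ≈ ιℕ R m + ιℕ R n
  ιℕ-+ m n = begin
    ιℕ R (m ℕ.+ n)     ≈⟨ ιℕ≈·1# (m ℕ.+ n) ⟩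
    (m ℕ.+ n) · 1#     ≈⟨ ×-homo-+ 1# m n ⟩
    m · 1# + n · 1#    ≈⟨ sym (+-cong (ιℕ≈·1# m) (ιℕ≈·1# n)) ⟩
    ιℕ R m + ιℕ R n    ∎

  ιℕ-* : ∀ m n → ιℕ R (m ℕ.* n) ≈ ιℕ R m * ιℕ R n
  ιℕ-* m n = begin
    ιℕ R (m ℕ.* n)        ≈⟨ ιℕ≈·1# (m ℕ.* n) ⟩
    (m ℕ.* n) · 1#        ≈⟨ ×1-homo-* m n ⟩
    (m · 1#) * (n · 1#)   ≈⟨ sym (*-cong (ιℕ≈·1# m) (ιℕ≈·1# n)) ⟩
    ιℕ R m * ιℕ R n       ∎

  [x+y]-[x+z]≈y-z : ∀ x y z → (x + y) - (x + z) ≈ y - z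
  [x+y]-[x+z]≈y-z x y z = begin
    (x + y) + - (x + z)   ≈⟨ +-congˡ (sym (-‿+-comm x z)) ⟩
    (x + y) + (- x + - z) ≈⟨ +-congʳ (+-comm x y) ⟩
    (y + x) + (- x + - z) ≈⟨ +-assoc y x _ ⟩
    y + (x + (- x + - z)) ≈⟨ +-congˡ (sym (+-assoc x (- x) _)) ⟩
    y + ((x + - x) + - z) ≈⟨ +-congˡ (+-congʳ (-‿inverseʳ x)) ⟩
    y + (0# + - z)        ≈⟨ +-congˡ (+-identityˡ _) ⟩
    y - z                 ∎

  ιℤ-⊖ : ∀ m n → ιℤ R (m ⊖ n) ≈ ιℕ R m - ιℕ R n
  ιℤ-⊖ zero    zero    = sym (-‿inverseʳ 0#)
  ιℤ-⊖ zero    (suc n) = sym (+-identityˡ _)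
  ιℤ-⊖ (suc m) zero    = sym (trans (+-congˡ -0#≈0#) (+-identityʳ _))
  ιℤ-⊖ (suc m) (suc n) = begin
    ιℤ R (suc m ⊖ suc n)        ≡⟨ ≡.cong (ιℤ R) (ℤ.[1+m]⊖[1+n]≡m⊖n m n) ⟩
    ιℤ R (m ⊖ n)                ≈⟨ ιℤ-⊖ m n ⟩
    ιℕ R m - ιℕ R n             ≈⟨ sym ([x+y]-[x+z]≈y-z 1# _ _) ⟩
    ιℕ R (suc m) - ιℕ R (suc n) ∎

  ιℤ-neg : ∀ i → ιℤ R (ℤ.- i) ≈ - ιℤ R i
  ιℤ-neg -[1+ n ]   = sym (-‿involutive _)
  ιℤ-neg (+ zero)   = sym -0#≈0#
  ιℤ-neg (+ suc n)  = refl

  ιℤ-+ : ∀ i j → ιℤ R (i ℤ.+ j) ≈ ιℤ R i + ιℤ R j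
  ιℤ-+ -[1+ m ] -[1+ n ] = begin
    - ιℕ R (suc (suc (m ℕ.+ n)))    ≡⟨ ≡.cong (λ k → - ιℕ R (suc k)) (≡.sym (ℕ.+-suc m n)) ⟩
    - ιℕ R (suc m ℕ.+ suc n)        ≈⟨ -‿cong (ιℕ-+ (suc m) (suc n)) ⟩
    - (ιℕ R (suc m) + ιℕ R (suc n)) ≈⟨ sym (-‿+-comm _ _) ⟩
    - ιℕ R (suc m) + - ιℕ R (suc n) ∎
  ιℤ-+ -[1+ m ] (+ n)    = trans (ιℤ-⊖ n (suc m)) (+-comm _ _)
  ιℤ-+ (+ m)    -[1+ n ] = ιℤ-⊖ m (suc n)
  ιℤ-+ (+ m)    (+ n)    = ιℕ-+ m n

  ιℤ-* : ∀ i j → ιℤ R (i ℤ.* j) ≈ ιℤ R i * ιℤ R j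
  ιℤ-* (+ m)      (+ n)      = trans (ιℤ-+◃ (m ℕ.* n)) (ιℕ-* m n)
    where
    ιℤ-+◃ : ∀ k → ιℤ R (Sign.+ ℤ.◃ k) ≈ ιℕ R k
    ιℤ-+◃ zero    = refl
    ιℤ-+◃ (suc k) = refl
  ιℤ-* (+ zero)   -[1+ n ]   = sym (zeroˡ _)
  ιℤ-* (+ suc m)  -[1+ n ]   = trans (-‿cong (ιℕ-* (suc m) (suc n))) (-‿distribʳ-* _ _)
  ιℤ-* -[1+ m ]   (+ zero)   rewrite ℕ.*-zeroʳ m = sym (zeroʳ _)
  ιℤ-* -[1+ m ]   (+ suc n)  = trans (-‿cong (ιℕ-* (suc m) (suc n))) (-‿distribˡ-* _ _)
  ιℤ-* -[1+ m ]   -[1+ n ]   = begin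
    ιℕ R (suc m ℕ.* suc n)              ≈⟨ ιℕ-* (suc m) (suc n) ⟩
    ιℕ R (suc m) * ιℕ R (suc n)         ≈⟨ sym (-‿involutive _) ⟩
    - - (ιℕ R (suc m) * ιℕ R (suc n))   ≈⟨ -‿cong (-‿distribˡ-* _ _) ⟩
    - (- ιℕ R (suc m) * ιℕ R (suc n))   ≈⟨ -‿distribʳ-* _ _ ⟩
    - ιℕ R (suc m) * - ιℕ R (suc n)     ∎

  ιℤ-morphism : AlmostCommutativeRing._-Raw-AlmostCommutative⟶_ +-*-rawRing
                  (AlmostCommutativeRing.fromCommutativeRing commutativeRing)
  ιℤ-morphism = record
    { ⟦_⟧ = ιℤ R ; +-homo = ιℤ-+ ; *-homo = ιℤ-* ; -‿homo = ιℤ-neg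
    ; 0-homo = refl ; 1-homo = +-identityʳ 1# }

  ιℤ-≟ : ∀ i j → Maybe (ιℤ R i ≈ ιℤ R j)
  ιℤ-≟ i j with i ℤ.≟ j
  ... | yes ≡.refl = just refl
  ... | no _       = nothing

  open import Algebra.Solver.Ring +-*-rawRing
    (AlmostCommutativeRing.fromCommutativeRing commutativeRing) ιℤ-morphism ιℤ-≟
    using (Polynomial; var; _:+_; _:*_; _:-_; :-_; prove; solve; _:=_)

  open module Sym = CayleyDickson {Polynomial 16} _:+_ _:*_ _:-_ :-_
    using () renaming (O to SymOct)

  x y : SymOct
  x = (((var (# 0) , var (# 1)) , (var (# 2) , var (# 3))) ,
       ((var (# 4) , var (# 5)) , (var (# 6) , var (# 7))))
  y = (((var (# 8) , var (# 9)) , (var (# 10) , var (# 11))) ,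
       ((var (# 12) , var (# 13)) , (var (# 14) , var (# 15))))

  coordinates : Oct R → Vec Carrier 8
  coordinates (((x₀ , x₁) , (x₂ , x₃)) , ((x₄ , x₅) , (x₆ , x₇))) =
    x₀ ∷ x₁ ∷ x₂ ∷ x₃ ∷ x₄ ∷ x₅ ∷ x₆ ∷ x₇ ∷ []

  valuation : Oct R → Oct R → Vec Carrier 16
  valuation a b = coordinates a ++ coordinates b

  module _ (a b : Oct R) where
    norm-+ : 𝒩 R (addO R a b) ≈ (𝒩 R a + 𝒩 R b) + (⟪_,_⟫ R a b + ⟪_,_⟫ R a b)
    norm-+ = prove (valuation a b) (Sym.norm (Sym.addO x y))
      ((Sym.norm x :+ Sym.norm y) :+ (Sym.dot x y :+ Sym.dot x y)) refl

    norm-* : 𝒩 R (mulO R a b) ≈ 𝒩 R a * 𝒩 R b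
    norm-* = prove (valuation a b) (Sym.norm (Sym.mulO x y))
      (Sym.norm x :* Sym.norm y) refl

    trace-+ : 𝒮 R (addO R a b) ≈ 𝒮 R a + 𝒮 R b
    trace-+ = prove (valuation a b) (Sym.trace (Sym.addO x y))
      (Sym.trace x :+ Sym.trace y) refl

    -- S(ab) = 2 Re(ab) = 2⟨a, b̄⟩
    trace-* : 𝒮 R (mulO R a b) ≈ ⟪_,_⟫ R a (conjO R b) + ⟪_,_⟫ R a (conjO R b)
    trace-* = prove (valuation a b) (Sym.trace (Sym.mulO x y))
      (Sym.dot x (Sym.conjO y) :+ Sym.dot x (Sym.conjO y)) refl

    twice-dot : ⟪_,_⟫ R a b + ⟪_,_⟫ R a b ≈ 𝒩 R (addO R a b) - (𝒩 R a + 𝒩 R b)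
    twice-dot = begin
      ⟪_,_⟫ R a b + ⟪_,_⟫ R a b               ≈⟨ solve 2 (λ n t → t := (n :+ t) :- n) refl
                                                     (𝒩 R a + 𝒩 R b) (⟪_,_⟫ R a b + ⟪_,_⟫ R a b) ⟩
      ((𝒩 R a + 𝒩 R b) + (⟪_,_⟫ R a b + ⟪_,_⟫ R a b)) - (𝒩 R a + 𝒩 R b)
                                              ≈⟨ +-congʳ (sym norm-+) ⟩
      𝒩 R (addO R a b) - (𝒩 R a + 𝒩 R b)     ∎

  -- A predicate on ℝ that respects equality and contains the values of
  -- ring operations on its members (it need not contain 0 or 1).
  record IsSubring (P : Carrier → Set) : Set where
    field
      respects : ∀ {r s} → r ≈ s → P r → P s
      +-closed : ∀ {r s} → P r → P s → P (r + s)
      *-closed : ∀ {r s} → P r → P s → P (r * s)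
      neg-closed : ∀ {r} → P r → P (- r)

  -- The rationals form a subring: a/d + b/e = (ae + bd)/(de) and
  -- (a/d)(b/e) = ab/(de), transported along ιℤ.
  rationals : IsSubring (IsRat R)
  rationals = record
    { respects   = λ r≈s (n , d , e) → n , d , trans (*-congˡ (sym r≈s)) e
    ; +-closed   = rat-+
    ; *-closed   = rat-*
    ; neg-closed = λ (n , d , e) →
        ℤ.- n , d , trans (sym (-‿distribʳ-* _ _)) (trans (-‿cong e) (sym (ιℤ-neg n)))
    }
    where
    -- the common denominator (1+d₁)(1+d₂), as (1+d) for the witness d below
    rat-+ : ∀ {r s} → IsRat R r → IsRat R s → IsRat R (r + s)
    rat-+ {r} {s} (n₁ , d₁ , e₁) (n₂ , d₂ , e₂) =
      n₁ ℤ.* + suc d₂ ℤ.+ n₂ ℤ.* + suc d₁ , d₂ ℕ.+ d₁ ℕ.* suc d₂ , (begin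
        ιℕ R (suc d₁ ℕ.* suc d₂) * (r + s)    ≈⟨ *-congʳ (ιℕ-* (suc d₁) (suc d₂)) ⟩
        (D₁ * D₂) * (r + s)                   ≈⟨ solve 4 (λ D₁ D₂ r s →
                                                    (D₁ :* D₂) :* (r :+ s) := (D₁ :* r) :* D₂ :+ (D₂ :* s) :* D₁)
                                                    refl D₁ D₂ r s ⟩
        (D₁ * r) * D₂ + (D₂ * s) * D₁         ≈⟨ +-cong (*-congʳ e₁) (*-congʳ e₂) ⟩
        ιℤ R n₁ * D₂ + ιℤ R n₂ * D₁           ≈⟨ sym (+-cong (ιℤ-* n₁ (+ suc d₂)) (ιℤ-* n₂ (+ suc d₁))) ⟩
        ιℤ R (n₁ ℤ.* + suc d₂) + ιℤ R (n₂ ℤ.* + suc d₁)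
                                              ≈⟨ sym (ιℤ-+ (n₁ ℤ.* + suc d₂) (n₂ ℤ.* + suc d₁)) ⟩
        ιℤ R (n₁ ℤ.* + suc d₂ ℤ.+ n₂ ℤ.* + suc d₁) ∎)
      where
      D₁ = ιℕ R (suc d₁)
      D₂ = ιℕ R (suc d₂)

    rat-* : ∀ {r s} → IsRat R r → IsRat R s → IsRat R (r * s)
    rat-* {r} {s} (n₁ , d₁ , e₁) (n₂ , d₂ , e₂) =
      n₁ ℤ.* n₂ , d₂ ℕ.+ d₁ ℕ.* suc d₂ , (begin
        ιℕ R (suc d₁ ℕ.* suc d₂) * (r * s)    ≈⟨ *-congʳ (ιℕ-* (suc d₁) (suc d₂)) ⟩
        (D₁ * D₂) * (r * s)                   ≈⟨ solve 4 (λ D₁ D₂ r s →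
                                                    (D₁ :* D₂) :* (r :* s) := (D₁ :* r) :* (D₂ :* s))
                                                    refl D₁ D₂ r s ⟩
        (D₁ * r) * (D₂ * s)                   ≈⟨ *-cong e₁ e₂ ⟩
        ιℤ R n₁ * ιℤ R n₂                     ≈⟨ sym (ιℤ-* n₁ n₂) ⟩
        ιℤ R (n₁ ℤ.* n₂)                      ∎)
      where
      D₁ = ιℕ R (suc d₁)
      D₂ = ιℕ R (suc d₂)

  integers : IsSubring (IsInt R)
  integers = record
    { respects   = λ r≈s (n , e) → n , trans (sym r≈s) e
    ; +-closed   = λ (n₁ , e₁) (n₂ , e₂) → n₁ ℤ.+ n₂ , trans (+-cong e₁ e₂) (sym (ιℤ-+ n₁ n₂))
    ; *-closed   = λ (n₁ , e₁) (n₂ , e₂) → n₁ ℤ.* n₂ , trans (*-cong e₁ e₂) (sym (ιℤ-* n₁ n₂))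
    ; neg-closed = λ (n , e) → ℤ.- n , trans (-‿cong e) (sym (ιℤ-neg n))
    }

  brandt-criterion : ∀ {P} → IsSubring P → (a b : Oct R) →
    P (𝒮 R a) × P (𝒩 R a) → P (𝒮 R b) × P (𝒩 R b) →
    (P (𝒩 R (addO R a b)) × P (𝒩 R (mulO R a b)) ×
     P (𝒮 R (addO R a b)) × P (𝒮 R (mulO R a b)))
    ⇔
    (P (⟪_,_⟫ R a b + ⟪_,_⟫ R a b) × P (⟪_,_⟫ R a (conjO R b) + ⟪_,_⟫ R a (conjO R b)))
  brandt-criterion P-subring a b (Sa , Na) (Sb , Nb) = mk⇔
    (λ (Nab , _ , _ , Sab) →
       respects (sym (twice-dot a b)) (+-closed Nab (neg-closed Na+Nb)) ,
       respects (trace-* a b) Sab)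
    (λ (2⟨a,b⟩ , 2⟨a,b̄⟩) →
       respects (sym (norm-+ a b)) (+-closed Na+Nb 2⟨a,b⟩) ,
       respects (sym (norm-* a b)) (*-closed Na Nb) ,
       respects (sym (trace-+ a b)) (+-closed Sa Sb) ,
       respects (sym (trace-* a b)) 2⟨a,b̄⟩)
    where
    open IsSubring P-subring
    Na+Nb = +-closed Na Nb

proposition3p2 : (R : RealField) → (a b : Oct R) →
    (RationalOct R a → RationalOct R b →
    ((IsRat R (𝒩 R (addO R a b)) × IsRat R (𝒩 R (mulO R a b)) ×
    IsRat R (𝒮 R (addO R a b)) × IsRat R (𝒮 R (mulO R a b)))
    ⇔
    (IsRat R (RealField._+_ R (⟪_,_⟫ R a b) (⟪_,_⟫ R a b)) ×
    IsRat R (RealField._+_ R (⟪_,_⟫ R a (conjO R b)) (⟪_,_⟫ R a (conjO R b))))))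
    ×
    (IntegralOct R a → IntegralOct R b →
    ((IsInt R (𝒩 R (addO R a b)) × IsInt R (𝒩 R (mulO R a b)) ×
    IsInt R (𝒮 R (addO R a b)) × IsInt R (𝒮 R (mulO R a b)))
    ⇔
    (IsInt R (RealField._+_ R (⟪_,_⟫ R a b) (⟪_,_⟫ R a b)) ×
    IsInt R (RealField._+_ R (⟪_,_⟫ R a (conjO R b)) (⟪_,_⟫ R a (conjO R b))))))
proposition3p2 R a b =
  brandt-criterion R (rationals R) a b , brandt-criterion R (integers R) a b
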